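{- Let $G$ be a long-refinement graph with $\deg(G) = \{2,3\}$ such that there is an $i \in \mathbb{N}_0$ for which every class of $\pi^i_G$ has exactly two elements, and let $\prec$ be the splitting order of the pairs. If $P_1, P_2$ are successive pairs (i.e.\ $P_2$ is the successor of $P_1$ with respect to $\prec$), then the graph $G[P_1,P_2]$ is a matching, i.e.\ every vertex of $P_1 \cup P_2$ has exactly one neighbour in $G[P_1,P_2]$.
   Context: All graphs are finite, simple, undirected, with monochromatic initial colouring. Colour Refinement computes $\chi^0_G$ constant and $\chi^i_G(v) = \big(\chi^{i-1}_G(v), \{\!\{\chi^{i-1}_G(w) \mid w \in N(v)\}\!\}\big)$; $\pi^i_G$ is the partition of $V(G)$ into colour classes of $\chi^i_G$, and $\mathrm{WL}_1(G)$ is the least $j \geq 0$ with $\pi^j_G = \pi^{j+1}_G$. A long-refinement graph is a graph $G$ with $\mathrm{WL}_1(G) = |G|-1$; $\deg(G) = \{\deg(v) \mid v \in V(G)\}$. In the setting of the claim, the pairs are the elements of $\pi^i_G$ (two-element colour classes); each pair is eventually split into two singletons, and (as $G$ is a long-refinement graph, each iteration splits exactly one class) distinct pairs are split in distinct iterations. The splitting order $\prec$ is the linear order on the pairs with $P \prec P'$ iff $P$ is split into singletons in an earlier iteration than $P'$. For vertex sets $A,B$, $G[A,B]$ is the graph with vertex set $A \cup B$ whose edges are the edges of $G$ with one endpoint in $A$ and the other in $B$. -}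

module Defs where

open import Data.Nat using (ℕ; zero; suc; _+_; _∸_; _<_; _≡ᵇ_)
open import Data.Bool using (Bool; true; false; _∧_; _∨_; if_then_else_; T)
open import Data.Fin using (Fin; _≟_)
open import Data.List using (List; allFin; map)
open import Data.Nat.ListAction using (sum)
open import Data.Bool.ListAction using (all)
open import Data.Product using (_×_; ∃-syntax)
open import Data.Sum using (_⊎_)
open import Relation.Nullary using (¬_; ⌊_⌋)
open import Relation.Binary.PropositionalEquality using (_≡_)

record Graph (n : ℕ) : Set where
  field
    adj    : Fin n → Fin n → Bool
    sym    : ∀ u v → adj u v ≡ adj v u
    irrefl : ∀ v → adj v v ≡ false
open Graph public

module _ {n : ℕ} (G : Graph n) where

  count : (Fin n → Bool) → ℕ
  count p = sum (map (λ x → if p x then 1 else 0) (allFin n))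

  degree : Fin n → ℕ
  degree v = count (adj G v)

  mutual
    -- sameColour i u v  ⇔  χ^i_G(u) = χ^i_G(v)   (monochromatic start)
    sameColour : ℕ → Fin n → Fin n → Bool
    sameColour zero    u v = true
    sameColour (suc i) u v =
      sameColour i u v ∧ all (λ w → nbCount i u w ≡ᵇ nbCount i v w) (allFin n)

    -- number of neighbours of u having colour χ^i(w); equality of these counts
    -- for all w is exactly equality of the multisets {{χ^i(x) | x ∈ N(·)}}
    nbCount : ℕ → Fin n → Fin n → ℕ
    nbCount i u w = sum (map (λ x → if adj G u x ∧ sameColour i x w then 1 else 0) (allFin n))

  _~[_]_ : Fin n → ℕ → Fin n → Set
  u ~[ i ] v = T (sameColour i u v)

  SamePartition : ℕ → ℕ → Set
  SamePartition i j = ∀ u v → sameColour i u v ≡ sameColour j u v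

  IsWL1 : ℕ → Set
  IsWL1 k = SamePartition k (suc k) × (∀ j → j < k → ¬ SamePartition j (suc j))

  LongRefinement : Set
  LongRefinement = IsWL1 (n ∸ 1)

  DegSet23 : Set
  DegSet23 = (∀ v → degree v ≡ 2 ⊎ degree v ≡ 3)
           × (∃[ v ] degree v ≡ 2) × (∃[ v ] degree v ≡ 3)

  classSize : ℕ → Fin n → ℕ
  classSize i v = count (λ u → sameColour i u v)

  -- the pair {a,b} (a class of π^i) is split into singletons in iteration j+1,
  -- i.e. {a,b} is a class of π^j but not of π^(j+1)
  SplitAt : Fin n → Fin n → ℕ → Set
  SplitAt a b j = a ~[ j ] b × ¬ (a ~[ suc j ] b)

  inPair : Fin n → Fin n → Fin n → Bool
  inPair a b x = ⌊ x ≟ a ⌋ ∨ ⌊ x ≟ b ⌋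

  nbIn : Fin n → Fin n → Fin n → ℕ
  nbIn x a b = count (λ y → adj G x y ∧ inPair a b y)

module Submission where

-- Let P₁ = {a₁,b₁} and P₂ = {a₂,b₂} be pairs of π^i split in rounds j₁ < j₂, no pair splitting
-- in between.  The excess of π^k, the number of vertices that are not the least vertex
--    of their colour class, starts at most n-1, never grows, and drops in every round before n-1
--    of a long-refinement graph; so it drops by at most one per round (module Budget).  A split
--    pair makes its larger vertex newly minimal, hence two disjoint pairs never split in the same
--    round (disjointSplits).
-- 2. Causes of splits.  If a pair splits in round k+1, some class of π^{k+1}, say that of w,
--    separates it by neighbour counts, and the class of w lost a vertex in round k (splitCause).
--    Hence j₂ = j₁ + 1 and w ∈ P₁.
-- 3. Matching.  The class of w is P₁ in π^{j₁} and {w} in π^{j₁+1}: a₂ and b₂ have equally many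
--    neighbours in P₁ but differ in adjacency to w, and a 2×2 truth table yields the matching.

open import Defs hiding (sym)

open import Data.Bool using (Bool; true; false; _∧_; _∨_; not; T; if_then_else_)
open import Data.Bool.Properties using (T?; T-∧; T-∨; T-≡; ⇔→≡; ∧-zeroʳ; ∧-identityʳ)
open import Data.Empty using (⊥; ⊥-elim)
open import Data.Fin using (Fin; zero; suc; toℕ; punchIn) renaming (_<_ to _<ᶠ_)
open import Data.Fin.Induction using (<-wellFounded)
open import Data.Fin.Properties using (any?; ¬∀⟶∃¬; punchInᵢ≢i)
  renaming (_<?_ to _<ᶠ?_; _≟_ to _≟ᶠ_; <-cmp to <ᶠ-cmp)
open import Data.List using (tabulate; allFin)
open import Data.List.Properties using (map-tabulate; map-cong)
open import Data.List.Membership.Propositional.Properties using (∈-allFin)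
open import Data.List.Relation.Unary.All as All using ()
open import Data.List.Relation.Unary.All.Properties using (all⁺; all⁻)
open import Data.Nat using (ℕ; zero; suc; _+_; _∸_; _<_; _≤_; z≤n; s≤s; _≤?_)
open import Data.Nat.Properties
open import Algebra.Properties.CommutativeMonoid.Sum +-0-commutativeMonoid
  using (sum-syntax; ∑-distrib-+; sum-remove; sum-cong-≗; sum-replicate-zero)
import Data.Nat.ListAction as ListAction
open import Data.Product using (_×_; _,_; proj₁; proj₂; ∃; ∃₂)
open import Data.Sum as Sum using (_⊎_; inj₁; inj₂)
open import Data.Unit using (tt)
open import Function using (_∘_; id)
open import Function.Bundles using (mk⇔; Equivalence)
open import Induction.WellFounded using (Acc; acc)
open import Relation.Binary.Definitions using (tri<; tri≈; tri>)
open import Relation.Binary.PropositionalEquality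
open import Relation.Nullary using (¬_; Dec; yes; no; ⌊_⌋)
open import Relation.Nullary.Decidable
  using (_×-dec_; ¬?; _⊎-dec_; toWitness; fromWitness; decidable-stable)

open Equivalence using (to; from)
open ≤-Reasoning

ind : Bool → ℕ
ind b = if b then 1 else 0

ind-true : ∀ {b} → T b → ind b ≡ 1
ind-true {true} _ = refl

ind-false : ∀ {b} → ¬ T b → ind b ≡ 0
ind-false {false} _ = refl
ind-false {true}  ¬t = ⊥-elim (¬t tt)

ind≤1 : ∀ b → ind b ≤ 1
ind≤1 true  = ≤-refl
ind≤1 false = z≤n

T-not : ∀ {b} → ¬ T b → T (not b)
T-not {false} _  = tt
T-not {true}  ¬t = ¬t tt

T-ext : ∀ {a b} → (T a → T b) → (T b → T a) → a ≡ b
T-ext f g = ⇔→≡ {z = true} (mk⇔ (to T-≡ ∘ f ∘ from T-≡) (to T-≡ ∘ g ∘ from T-≡))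

noDifference : ∀ {b c : Bool} → ¬ (b ≢ b ⊎ c ≢ c)
noDifference (inj₁ ne) = ne refl
noDifference (inj₂ ne) = ne refl

-- A 2×2 truth table: if u₁, u₂ (rows α β and γ δ) have equally many neighbours in {v₁, v₂} but
-- differ in adjacency to one of v₁, v₂, then the adjacencies form a perfect matching.
matching2×2 : ∀ α β γ δ → ind α + ind β ≡ ind γ + ind δ → α ≢ γ ⊎ β ≢ δ →
  (ind α + ind γ ≡ 1 × ind β + ind δ ≡ 1) × (ind α + ind β ≡ 1 × ind γ + ind δ ≡ 1)
matching2×2 true  false false true  _ _ = (refl , refl) , (refl , refl)
matching2×2 false true  true  false _ _ = (refl , refl) , (refl , refl)
matching2×2 true  true  true  true  _ ne = ⊥-elim (noDifference ne)
matching2×2 true  false true  false _ ne = ⊥-elim (noDifference ne)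
matching2×2 false true  false true  _ ne = ⊥-elim (noDifference ne)
matching2×2 false false false false _ ne = ⊥-elim (noDifference ne)
matching2×2 true  true  true  false () _
matching2×2 true  true  false true  () _
matching2×2 true  true  false false () _
matching2×2 true  false true  true  () _
matching2×2 true  false false false () _
matching2×2 false true  true  true  () _
matching2×2 false true  false false () _
matching2×2 false false true  true  () _
matching2×2 false false true  false () _
matching2×2 false false false true  () _

-- Counting subsets of Fin n.  The counts in Defs are list sums; we work with the equal
-- functional sum, for which the standard library provides additivity and removal of a point.
private variable n : ℕ

_==_ : Fin n → Fin n → Bool
x == a = ⌊ x ≟ᶠ a ⌋

size : (Fin n → Bool) → ℕ
size {n} p = ∑[ x < n ] ind (p x)

count≡size : (G : Graph n) (p : Fin n → Bool) → count G p ≡ size p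
count≡size G p = trans (cong ListAction.sum (map-tabulate id (ind ∘ p))) (sumTabulate (ind ∘ p))
  where
  sumTabulate : ∀ {m} (f : Fin m → ℕ) → ListAction.sum (tabulate f) ≡ ∑[ x < m ] f x
  sumTabulate {zero}  f = refl
  sumTabulate {suc m} f = cong (f zero +_) (sumTabulate (f ∘ suc))

count-cong : (G : Graph n) {p q : Fin n → Bool} → (∀ x → p x ≡ q x) → count G p ≡ count G q
count-cong {n} G p≡q = cong ListAction.sum (map-cong (cong ind ∘ p≡q) (allFin n))

size-+ : ∀ {p q r : Fin n → Bool} → (∀ x → ind (r x) ≡ ind (p x) + ind (q x)) →
  size r ≡ size p + size q
size-+ {p = p} {q = q} pointwise = trans (sum-cong-≗ pointwise) (∑-distrib-+ (ind ∘ p) (ind ∘ q))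

size-only : ∀ (p : Fin n → Bool) a → (∀ x → x ≢ a → p x ≡ false) → size p ≡ ind (p a)
size-only {suc n} p a outside = begin-equality
  size p                                      ≡⟨ sum-remove {i = a} (ind ∘ p) ⟩
  ind (p a) + ∑[ j < n ] ind (p (punchIn a j)) ≡⟨ cong (ind (p a) +_) restVanishes ⟩
  ind (p a) + 0                               ≡⟨ +-identityʳ _ ⟩
  ind (p a)                                   ∎
  where
  restVanishes : ∑[ j < n ] ind (p (punchIn a j)) ≡ 0
  restVanishes =
    trans (sum-cong-≗ (λ j → cong ind (outside _ (punchInᵢ≢i a j)))) (sum-replicate-zero n)

size-at : ∀ (p : Fin n → Bool) a → size (λ x → p x ∧ x == a) ≡ ind (p a)
size-at p a = trans (size-only _ a outside) (cong ind atA)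
  where
  outside : ∀ x → x ≢ a → p x ∧ x == a ≡ false
  outside x x≢a with x ≟ᶠ a
  ... | yes x≡a = ⊥-elim (x≢a x≡a)
  ... | no _    = ∧-zeroʳ (p x)
  atA : p a ∧ a == a ≡ p a
  atA with a ≟ᶠ a
  ... | yes _   = ∧-identityʳ (p a)
  ... | no a≢a = ⊥-elim (a≢a refl)

size-pair : ∀ (p : Fin n → Bool) {a b} → a ≢ b →
  size (λ x → p x ∧ (x == a ∨ x == b)) ≡ ind (p a) + ind (p b)
size-pair p {a} {b} a≢b = trans (size-+ pointwise) (cong₂ _+_ (size-at p a) (size-at p b))
  where
  pointwise : ∀ x → ind (p x ∧ (x == a ∨ x == b)) ≡ ind (p x ∧ x == a) + ind (p x ∧ x == b)
  pointwise x with x ≟ᶠ a | x ≟ᶠ b | p x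
  ... | yes refl | yes a≡b | _    = ⊥-elim (a≢b a≡b)
  ... | _        | _       | false = refl
  ... | yes _    | no _    | true = refl
  ... | no _     | yes _   | true = refl
  ... | no _     | no _    | true = refl

_∖_ : (Fin n → Bool) → Fin n → (Fin n → Bool)
(p ∖ a) x = p x ∧ not (x == a)

∖-intro : ∀ (p : Fin n → Bool) {a x} → T (p x) → x ≢ a → T ((p ∖ a) x)
∖-intro p px x≢a = from T-∧ (px , T-not (x≢a ∘ toWitness))

size-remove : ∀ (p : Fin n → Bool) a → T (p a) → size p ≡ suc (size (p ∖ a))
size-remove p a pa =
  trans (size-+ pointwise) (cong (_+ size (p ∖ a)) (trans (size-at p a) (ind-true pa)))
  where
  pointwise : ∀ x → ind (p x) ≡ ind (p x ∧ x == a) + ind ((p ∖ a) x)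
  pointwise x with p x | x == a
  ... | false | _     = refl
  ... | true  | true  = refl
  ... | true  | false = refl

atLeastOne : ∀ (p : Fin n → Bool) {a} → T (p a) → 1 ≤ size p
atLeastOne p {a} pa rewrite size-remove p a pa = s≤s z≤n

atLeastTwo : ∀ (p : Fin n → Bool) {a b} → a ≢ b → T (p a) → T (p b) → 2 ≤ size p
atLeastTwo p {a} {b} a≢b pa pb rewrite size-remove p a pa =
  s≤s (atLeastOne (p ∖ a) (∖-intro p pb (a≢b ∘ sym)))

atLeastThree : ∀ (p : Fin n → Bool) {a b c} → a ≢ b → a ≢ c → b ≢ c →
  T (p a) → T (p b) → T (p c) → 3 ≤ size p
atLeastThree p {a} a≢b a≢c b≢c pa pb pc rewrite size-remove p a pa =
  s≤s (atLeastTwo (p ∖ a) b≢c (∖-intro p pb (a≢b ∘ sym)) (∖-intro p pc (a≢c ∘ sym)))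

size-⊆ : ∀ {p q : Fin n → Bool} → (∀ x → T (p x) → T (q x)) →
  size q ≡ size p + size (λ x → q x ∧ not (p x))
size-⊆ {p = p} {q = q} p⊆q = size-+ pointwise
  where
  pointwise : ∀ x → ind (q x) ≡ ind (p x) + ind (q x ∧ not (p x))
  pointwise x with p x | q x | p⊆q x
  ... | true  | true  | _    = refl
  ... | true  | false | incl = ⊥-elim (incl tt)
  ... | false | true  | _    = refl
  ... | false | false | _    = refl

size≤n : ∀ (p : Fin n → Bool) → size p ≤ n
size≤n {zero}  p = z≤n
size≤n {suc n} p = +-mono-≤ (ind≤1 (p zero)) (size≤n (p ∘ suc))

size-≤-pred : ∀ (p : Fin n → Bool) → (∀ a → toℕ a ≡ 0 → ¬ T (p a)) → size p ≤ n ∸ 1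
size-≤-pred {zero}  p _         = z≤n
size-≤-pred {suc n} p notFirst = begin
  ind (p zero) + size (p ∘ suc)  ≡⟨ cong (_+ size (p ∘ suc)) (ind-false (notFirst zero refl)) ⟩
  size (p ∘ suc)                 ≤⟨ size≤n (p ∘ suc) ⟩
  n                              ∎

OneOf : Fin n → Fin n → Fin n → Set
OneOf y a b = y ≡ a ⊎ y ≡ b

oneOf⁺ : ∀ {y a b : Fin n} → OneOf y a b → T (y == a ∨ y == b)
oneOf⁺ {y = y} {a} {b} = from T-∨ ∘ Sum.map (fromWitness {a? = y ≟ᶠ a}) (fromWitness {a? = y ≟ᶠ b})

oneOf⁻ : ∀ {y a b : Fin n} → T (y == a ∨ y == b) → OneOf y a b
oneOf⁻ {y = y} {a} {b} = Sum.map (toWitness {a? = y ≟ᶠ a}) (toWitness {a? = y ≟ᶠ b}) ∘ to T-∨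

module Budget (f : ℕ → ℕ) (m : ℕ) (start : f 0 ≤ m)
              (antitone : ∀ k → f (suc k) ≤ f k)
              (strict : ∀ k → k < m → f (suc k) < f k) where

  spent : ∀ k → k ≤ m → f k + k ≤ m
  spent zero    _   = subst (_≤ m) (sym (+-identityʳ (f 0))) start
  spent (suc k) k<m = begin
    f (suc k) + suc k    ≡⟨ +-suc (f (suc k)) k ⟩
    suc (f (suc k)) + k  ≤⟨ +-monoˡ-≤ k (strict k k<m) ⟩
    f k + k              ≤⟨ spent k (<⇒≤ k<m) ⟩
    m                    ∎

  unspent : ∀ d k → d + k ≡ m → m ≤ f k + k
  unspent zero    k k≡m   = ≤-trans (≤-reflexive (sym k≡m)) (m≤n+m k (f k))
  unspent (suc d) k d+k≡m = begin
    m                    ≤⟨ unspent d (suc k) (trans (+-suc d k) d+k≡m) ⟩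
    f (suc k) + suc k    ≡⟨ +-suc (f (suc k)) k ⟩
    suc (f (suc k)) + k  ≤⟨ +-monoˡ-≤ k (strict k k<m) ⟩
    f k + k              ∎
    where
    k<m : k < m
    k<m = ≤-trans (s≤s (m≤n+m k d)) (≤-reflexive d+k≡m)

  descend : ∀ d k → f (d + k) ≤ f k
  descend zero    k = ≤-refl
  descend (suc d) k = ≤-trans (antitone (d + k)) (descend d k)

  exhausted : f m ≤ 0
  exhausted = subst (f m ≤_) (n∸n≡0 m) (m+n≤o⇒m≤o∸n (f m) (spent m ≤-refl))

  atMostOneDrop : ∀ k → f k ≤ suc (f (suc k))
  atMostOneDrop k with suc k ≤? m
  ... | yes k<m = +-cancelʳ-≤ k (f k) (suc (f (suc k))) (begin
    f k + k              ≤⟨ spent k (<⇒≤ k<m) ⟩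
    m                    ≤⟨ unspent (m ∸ suc k) (suc k) (m∸n+n≡m k<m) ⟩
    f (suc k) + suc k    ≡⟨ +-suc (f (suc k)) k ⟩
    suc (f (suc k)) + k  ∎)
  ... | no k≮m = begin
    f k                  ≡⟨ cong f (sym (m∸n+n≡m m≤k)) ⟩
    f ((k ∸ m) + m)      ≤⟨ descend (k ∸ m) m ⟩
    f m                  ≤⟨ exhausted ⟩
    0                    ≤⟨ z≤n ⟩
    suc (f (suc k))      ∎
    where
    m≤k : m ≤ k
    m≤k = ≤-pred (≰⇒> k≮m)

-- Colour refinement on an arbitrary graph.
module Refinement {n : ℕ} (G : Graph n) where

  infix 4 _≈[_]_
  _≈[_]_ : Fin n → ℕ → Fin n → Set
  u ≈[ k ] v = T (sameColour G k u v)

  ≈-suc⁻ : ∀ k {u v} → u ≈[ suc k ] v → u ≈[ k ] v × (∀ w → nbCount G k u w ≡ nbCount G k v w)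
  ≈-suc⁻ k t =
    let u≈v , counts = to T-∧ t
    in u≈v , λ w → ≡ᵇ⇒≡ _ _ (All.lookup (all⁺ _ (allFin n) counts) (∈-allFin w))

  ≈-suc⁺ : ∀ k {u v} → u ≈[ k ] v → (∀ w → nbCount G k u w ≡ nbCount G k v w) → u ≈[ suc k ] v
  ≈-suc⁺ k u≈v counts =
    from T-∧ (u≈v , all⁻ _ (All.universal (λ w → ≡⇒≡ᵇ _ _ (counts w)) (allFin n)))

  ≈-refl : ∀ k v → v ≈[ k ] v
  ≈-refl zero    v = tt
  ≈-refl (suc k) v = ≈-suc⁺ k (≈-refl k v) (λ _ → refl)

  ≈-sym : ∀ k {u v} → u ≈[ k ] v → v ≈[ k ] u
  ≈-sym zero    _ = tt
  ≈-sym (suc k) t = let u≈v , counts = ≈-suc⁻ k t in ≈-suc⁺ k (≈-sym k u≈v) (sym ∘ counts)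

  ≈-trans : ∀ k {u v w} → u ≈[ k ] v → v ≈[ k ] w → u ≈[ k ] w
  ≈-trans zero    _ _ = tt
  ≈-trans (suc k) s t =
    let u≈v , counts₁ = ≈-suc⁻ k s
        v≈w , counts₂ = ≈-suc⁻ k t
    in ≈-suc⁺ k (≈-trans k u≈v v≈w) (λ x → trans (counts₁ x) (counts₂ x))

  ≈-mono : ∀ {j} k {u v} → j ≤ k → u ≈[ k ] v → u ≈[ j ] v
  ≈-mono zero    z≤n t = t
  ≈-mono (suc k) j≤k t with m≤n⇒m<n∨m≡n j≤k
  ... | inj₁ j<1+k = ≈-mono k (≤-pred j<1+k) (proj₁ (≈-suc⁻ k t))
  ... | inj₂ refl  = t

  split-≢ : ∀ k {x w} → SplitAt G x w k → x ≢ w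
  split-≢ k {x} (_ , x≉w) refl = x≉w (≈-refl (suc k) x)

  split-sym : ∀ k {x w} → SplitAt G x w k → SplitAt G w x k
  split-sym k (x≈w , x≉w) = ≈-sym k x≈w , x≉w ∘ ≈-sym (suc k)

  splitRound : ∀ {i j u v} → u ≈[ i ] v → SplitAt G u v j → i ≤ j
  splitRound {i} {j} u≈v (_ , u≉v) with i ≤? j
  ... | yes i≤j = i≤j
  ... | no  i≰j = ⊥-elim (u≉v (≈-mono i (≰⇒> i≰j) u≈v))

  splitAt? : ∀ x w k → Dec (SplitAt G x w k)
  splitAt? x w k = T? (sameColour G k x w) ×-dec ¬? (T? (sameColour G (suc k) x w))

  pairMembers : ∀ k {a b x y} → a ≈[ k ] b → OneOf x a b → OneOf y a b → x ≈[ k ] y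
  pairMembers k {a} a≈b (inj₁ refl) (inj₁ refl) = ≈-refl k a
  pairMembers k     a≈b (inj₁ refl) (inj₂ refl) = a≈b
  pairMembers k     a≈b (inj₂ refl) (inj₁ refl) = ≈-sym k a≈b
  pairMembers k {b = b} a≈b (inj₂ refl) (inj₂ refl) = ≈-refl k b

  stableClass : ∀ k w → (∀ x → ¬ SplitAt G x w k) →
    ∀ x → sameColour G (suc k) x w ≡ sameColour G k x w
  stableClass k w none x =
    T-ext (proj₁ ∘ ≈-suc⁻ k) (λ x≈w → decidable-stable (T? _) (λ x≉w → none x (x≈w , x≉w)))

  nbCount-cong : ∀ {j k w} → (∀ x → sameColour G j x w ≡ sameColour G k x w) →
    ∀ u → nbCount G j u w ≡ nbCount G k u w
  nbCount-cong same u = count-cong G (λ x → cong (adj G u x ∧_) (same x))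

  nbIn-pair : ∀ u {a b} → a ≢ b → nbIn G u a b ≡ ind (adj G u a) + ind (adj G u b)
  nbIn-pair u a≢b = trans (count≡size G _) (size-pair (adj G u) a≢b)

  nbIn-pair′ : ∀ u {a b} → a ≢ b → nbIn G u a b ≡ ind (adj G a u) + ind (adj G b u)
  nbIn-pair′ u {a} {b} a≢b =
    trans (nbIn-pair u a≢b) (cong₂ _+_ (cong ind (Graph.sym G u a)) (cong ind (Graph.sym G u b)))

  splitCause : ∀ k {a b} → SplitAt G a b (suc k) →
    ∃ λ w → nbCount G (suc k) a w ≢ nbCount G (suc k) b w × ∃ λ x → SplitAt G x w k
  splitCause k {a} {b} (a≈b , a≉b)
    with ¬∀⟶∃¬ n _ (λ w → nbCount G (suc k) a w ≟ nbCount G (suc k) b w) (a≉b ∘ ≈-suc⁺ (suc k) a≈b)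
  ... | w , differ with any? (λ x → splitAt? x w k)
  ...   | yes cause = w , differ , cause
  ...   | no  none  = ⊥-elim (differ (begin-equality
    nbCount G (suc k) a w  ≡⟨ unchanged a ⟩
    nbCount G k a w        ≡⟨ proj₂ (≈-suc⁻ k a≈b) w ⟩
    nbCount G k b w        ≡⟨ unchanged b ⟨
    nbCount G (suc k) b w  ∎))
    where
    unchanged : ∀ u → nbCount G (suc k) u w ≡ nbCount G k u w
    unchanged = nbCount-cong {suc k} {k} (stableClass k w (λ x s → none (x , s)))

  nonMinimal : ℕ → Fin n → Bool
  nonMinimal k v = ⌊ any? (λ u → u <ᶠ? v ×-dec T? (sameColour G k u v)) ⌋

  nonMinimal-intro : ∀ k {u v} → u <ᶠ v → u ≈[ k ] v → T (nonMinimal k v)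
  nonMinimal-intro k u<v u≈v = fromWitness (_ , u<v , u≈v)

  nonMinimal-elim : ∀ k {v} → T (nonMinimal k v) → ∃ λ u → u <ᶠ v × u ≈[ k ] v
  nonMinimal-elim k = toWitness

  nonMinimal-down : ∀ k {v} → T (nonMinimal (suc k) v) → T (nonMinimal k v)
  nonMinimal-down k t =
    let u , u<v , u≈v = nonMinimal-elim (suc k) t
    in nonMinimal-intro k u<v (proj₁ (≈-suc⁻ k u≈v))

  leastMember : ∀ k v → ∃ λ r → r ≈[ k ] v × ¬ T (nonMinimal k r)
  leastMember k v = descent v (<-wellFounded v)
    where
    descent : ∀ v → Acc _<ᶠ_ v → ∃ λ r → r ≈[ k ] v × ¬ T (nonMinimal k r)
    descent v (acc smaller) with T? (nonMinimal k v)
    ... | no  v-min = v , ≈-refl k v , v-min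
    ... | yes t     =
      let u , u<v , u≈v  = nonMinimal-elim k t
          r , r≈u , r-min = descent u (smaller u<v)
      in r , ≈-trans k r≈u u≈v , r-min

  minimal-unique : ∀ k {r s} → r ≈[ k ] s → ¬ T (nonMinimal k r) → ¬ T (nonMinimal k s) → r ≡ s
  minimal-unique k {r} {s} r≈s r-min s-min with <ᶠ-cmp r s
  ... | tri< r<s _ _ = ⊥-elim (s-min (nonMinimal-intro k r<s r≈s))
  ... | tri≈ _ r≡s _ = r≡s
  ... | tri> _ _ s<r = ⊥-elim (r-min (nonMinimal-intro k s<r (≈-sym k r≈s)))

  newlyMinimal : ℕ → Fin n → Bool
  newlyMinimal k v = nonMinimal k v ∧ not (nonMinimal (suc k) v)

  newlyMinimal-intro : ∀ k {v} → T (nonMinimal k v) → ¬ T (nonMinimal (suc k) v) →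
    T (newlyMinimal k v)
  newlyMinimal-intro k t ¬t = from T-∧ (t , T-not ¬t)

  -- a round without newly minimal vertices refines nothing: the least vertices of the classes of
  -- u and v in π^{k+1} are already least in π^k, hence coincide when u ≈[ k ] v
  noNewMinimal⇒stable : ∀ k → (∀ v → ¬ T (newlyMinimal k v)) → SamePartition G k (suc k)
  noNewMinimal⇒stable k none u v = T-ext refine (proj₁ ∘ ≈-suc⁻ k)
    where
    minimalBefore : ∀ {r} → ¬ T (nonMinimal (suc k) r) → ¬ T (nonMinimal k r)
    minimalBefore r-min t = none _ (newlyMinimal-intro k t r-min)
    refine : u ≈[ k ] v → u ≈[ suc k ] v
    refine u≈v =
      let r , r≈u , r-min = leastMember (suc k) u
          s , s≈v , s-min = leastMember (suc k) v
          r≈s = ≈-trans k (proj₁ (≈-suc⁻ k r≈u)) (≈-trans k u≈v (≈-sym k (proj₁ (≈-suc⁻ k s≈v))))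
          r≡s = minimal-unique k r≈s (minimalBefore r-min) (minimalBefore s-min)
      in ≈-trans (suc k) (≈-sym (suc k) r≈u) (subst (_≈[ suc k ] v) (sym r≡s) s≈v)

  -- the excess n − |π^k|: the number of vertices that are not least in their class
  excess : ℕ → ℕ
  excess k = size (nonMinimal k)

  -- the first vertex is always minimal
  excess-start : excess 0 ≤ n ∸ 1
  excess-start = size-≤-pred (nonMinimal 0) firstMinimal
    where
    firstMinimal : ∀ v → toℕ v ≡ 0 → ¬ T (nonMinimal 0 v)
    firstMinimal v v≡0 t with nonMinimal-elim 0 t
    ... | u , u<v , _ = n≮0 (subst (toℕ u <_) v≡0 u<v)

  excess-antitone : ∀ k → excess (suc k) ≤ excess k
  excess-antitone k =
    subst (excess (suc k) ≤_) (sym (size-⊆ (λ v → nonMinimal-down k {v}))) (m≤m+n _ _)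

  excess-drop : ∀ k c → c ≤ size (newlyMinimal k) → c + excess (suc k) ≤ excess k
  excess-drop k c c≤new = begin
    c + excess (suc k)                    ≤⟨ +-monoˡ-≤ (excess (suc k)) c≤new ⟩
    size (newlyMinimal k) + excess (suc k) ≡⟨ +-comm _ (excess (suc k)) ⟩
    excess (suc k) + size (newlyMinimal k) ≡⟨ size-⊆ (λ v → nonMinimal-down k {v}) ⟨
    excess k                              ∎

  excess-strict : ∀ k → ¬ SamePartition G k (suc k) → excess (suc k) < excess k
  excess-strict k changed with any? (λ v → T? (newlyMinimal k v))
  ... | yes (v , new) = excess-drop k 1 (atLeastOne (newlyMinimal k) new)
  ... | no  none      = ⊥-elim (changed (noNewMinimal⇒stable k (λ v new → none (v , new))))

-- Long-refinement graphs in which every class of π^i is a pair.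
module PairClasses {n : ℕ} (G : Graph n) (LR : LongRefinement G)
                   (i : ℕ) (pairs : ∀ v → classSize G i v ≡ 2) where
  open Refinement G

  open Budget excess (n ∸ 1) excess-start excess-antitone
              (λ k k<m → excess-strict k (proj₂ LR k k<m))
    using (atMostOneDrop)

  pairClass : ∀ {a b x y} → a ≢ b → a ≈[ i ] b → x ≈[ i ] y → OneOf y a b → OneOf x a b
  pairClass {a} {b} {x} a≢b a≈b x≈y y∈ab with x ≟ᶠ a | x ≟ᶠ b
  ... | yes x≡a | _       = inj₁ x≡a
  ... | no  _   | yes x≡b = inj₂ x≡b
  ... | no  x≢a | no  x≢b = ⊥-elim (<⇒≱ three (≤-reflexive classOfA))
    where
    x≈a : x ≈[ i ] a
    x≈a = ≈-trans i x≈y (pairMembers i a≈b y∈ab (inj₁ refl))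
    classOfA : size (λ u → sameColour G i u a) ≡ 2
    classOfA = trans (sym (count≡size G _)) (pairs a)
    three : 3 ≤ size (λ u → sameColour G i u a)
    three = atLeastThree _ a≢b (x≢a ∘ sym) (x≢b ∘ sym) (≈-refl i a) (≈-sym i a≈b) x≈a

  largerMinimal : ∀ {J s l} → i ≤ J → s <ᶠ l → s ≢ l → s ≈[ i ] l → SplitAt G s l J →
    T (newlyMinimal J l)
  largerMinimal {J} {l = l} i≤J s<l s≢l s≈l (s≈ₖl , s≉l) =
    newlyMinimal-intro J (nonMinimal-intro J s<l s≈ₖl) minimalAfter
    where
    -- after the split, the only candidate below l in its class, namely s, has left it
    minimalAfter : ¬ T (nonMinimal (suc J) l)
    minimalAfter t with nonMinimal-elim (suc J) t
    ... | u , u<l , u≈l with pairClass s≢l s≈l (≈-mono (suc J) (m≤n⇒m≤1+n i≤J) u≈l) (inj₂ refl)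
    ...   | inj₁ refl = s≉l u≈l
    ...   | inj₂ refl = <-irrefl refl u<l

  splitMinimal : ∀ {J a b} → i ≤ J → a ≢ b → a ≈[ i ] b → SplitAt G a b J →
    ∃ λ y → OneOf y a b × T (newlyMinimal J y)
  splitMinimal {J} {a} {b} i≤J a≢b a≈b split with <ᶠ-cmp a b
  ... | tri< a<b _ _ = b , inj₂ refl , largerMinimal i≤J a<b a≢b a≈b split
  ... | tri≈ _ a≡b _ = ⊥-elim (a≢b a≡b)
  ... | tri> _ _ b<a =
    a , inj₁ refl , largerMinimal i≤J b<a (a≢b ∘ sym) (≈-sym i a≈b) (split-sym J split)

  -- two disjoint pairs of π^i never split in the same round J ≥ i: their two newly minimal
  -- vertices would lower the excess by two
  disjointSplits : ∀ {J a b x w} → i ≤ J → a ≢ b → a ≈[ i ] b → SplitAt G a b J →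
    x ≢ w → x ≈[ i ] w → SplitAt G x w J → (∀ {y} → OneOf y a b → OneOf y x w → ⊥) → ⊥
  disjointSplits {J} i≤J a≢b a≈b splitAB x≢w x≈w splitXW disjoint
    with splitMinimal i≤J a≢b a≈b splitAB | splitMinimal i≤J x≢w x≈w splitXW
  ... | y₁ , y₁∈ab , new₁ | y₂ , y₂∈xw , new₂ = 1+n≰n (≤-trans twoDrops (atMostOneDrop J))
    where
    y₁≢y₂ : y₁ ≢ y₂
    y₁≢y₂ refl = disjoint y₁∈ab y₂∈xw
    twoDrops : 2 + excess (suc J) ≤ excess J
    twoDrops = excess-drop J 2 (atLeastTwo (newlyMinimal J) y₁≢y₂ new₁ new₂)

  oneSplitPerRound : ∀ {J a b x w} → i ≤ J → a ≢ b → a ≈[ i ] b → SplitAt G a b J →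
    SplitAt G x w J → OneOf w a b
  oneSplitPerRound {J} {a} {b} {x} {w} i≤J a≢b a≈b splitAB splitXW with (w ≟ᶠ a) ⊎-dec (w ≟ᶠ b)
  ... | yes w∈ab = w∈ab
  ... | no  w∉ab =
    ⊥-elim (disjointSplits i≤J a≢b a≈b splitAB (split-≢ J splitXW) x≈w splitXW disjoint)
    where
    x≈w : x ≈[ i ] w
    x≈w = ≈-mono J i≤J (proj₁ splitXW)
    disjoint : ∀ {y} → OneOf y a b → OneOf y x w → ⊥
    disjoint y∈ab (inj₁ refl) = w∉ab (pairClass a≢b a≈b (≈-sym i x≈w) y∈ab)
    disjoint y∈ab (inj₂ refl) = w∉ab y∈ab

  classBefore : ∀ {J a b w} → i ≤ J → a ≢ b → a ≈[ i ] b → a ≈[ J ] b → OneOf w a b →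
    ∀ x → sameColour G J x w ≡ (x == a ∨ x == b)
  classBefore {J} i≤J a≢b a≈b a≈ⱼb w∈ab x =
    T-ext (λ x≈w → oneOf⁺ (pairClass a≢b a≈b (≈-mono J i≤J x≈w) w∈ab))
          (λ x∈ab → pairMembers J a≈ⱼb (oneOf⁻ x∈ab) w∈ab)

  classAfter : ∀ {J a b w} → i ≤ J → a ≢ b → a ≈[ i ] b → SplitAt G a b J → OneOf w a b →
    ∀ x → sameColour G (suc J) x w ≡ x == w
  classAfter {J} {a} {b} {w} i≤J a≢b a≈b (_ , a≉b) w∈ab x = T-ext (fromWitness ∘ separated) joined
    where
    members : ∀ {x y} → OneOf x a b → OneOf y a b → x ≈[ suc J ] y → x ≡ y
    members (inj₁ refl) (inj₁ refl) _   = refl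
    members (inj₁ refl) (inj₂ refl) a≈b = ⊥-elim (a≉b a≈b)
    members (inj₂ refl) (inj₁ refl) b≈a = ⊥-elim (a≉b (≈-sym (suc J) b≈a))
    members (inj₂ refl) (inj₂ refl) _   = refl
    separated : x ≈[ suc J ] w → x ≡ w
    separated x≈w =
      members (pairClass a≢b a≈b (≈-mono (suc J) (m≤n⇒m≤1+n i≤J) x≈w) w∈ab) w∈ab x≈w
    joined : T (x == w) → x ≈[ suc J ] w
    joined x=w = subst (_≈[ suc J ] w) (sym (toWitness x=w)) (≈-refl (suc J) w)

  previousSplit : ∀ {m a b} → i ≤ m → SplitAt G a b (suc m) →
    ∃₂ λ x w → x ≢ w × x ≈[ i ] w × SplitAt G x w m
  previousSplit {m} i≤m split with splitCause m split
  ... | w , _ , x , splitXW = x , w , split-≢ m splitXW , ≈-mono m i≤m (proj₁ splitXW) , splitXW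

  successiveSplits : ∀ {J a₁ b₁ a₂ b₂} → i ≤ J → a₁ ≢ b₁ → a₁ ≈[ i ] b₁ → a₂ ≢ b₂ →
    SplitAt G a₁ b₁ J → SplitAt G a₂ b₂ (suc J) →
    (nbIn G a₁ a₂ b₂ ≡ 1 × nbIn G b₁ a₂ b₂ ≡ 1) × (nbIn G a₂ a₁ b₁ ≡ 1 × nbIn G b₂ a₁ b₁ ≡ 1)
  successiveSplits {J} {a₁} {b₁} {a₂} {b₂} i≤J a₁≢b₁ a₁≈b₁ a₂≢b₂ split₁ split₂
    with splitCause J split₂
  ... | w , differ , x , splitXW =
    let (r₁ , r₂) , (r₃ , r₄) = matching2×2 (adj G a₂ a₁) (adj G a₂ b₁) (adj G b₂ a₁) (adj G b₂ b₁)
                                            sameTotal adjacencyDiffers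
    in (trans (nbIn-pair′ a₁ a₂≢b₂) r₁ , trans (nbIn-pair′ b₁ a₂≢b₂) r₂)
     , (trans (nbIn-pair a₂ a₁≢b₁) r₃ , trans (nbIn-pair b₂ a₁≢b₁) r₄)
    where
    -- the class of π^{J+1} distinguishing a₂ from b₂ belongs to the only pair split in round J
    w∈P₁ : OneOf w a₁ b₁
    w∈P₁ = oneSplitPerRound i≤J a₁≢b₁ a₁≈b₁ split₁ splitXW
    classP₁ : ∀ y → sameColour G J y w ≡ (y == a₁ ∨ y == b₁)
    classP₁ = classBefore i≤J a₁≢b₁ a₁≈b₁ (proj₁ split₁) w∈P₁
    classW : ∀ y → sameColour G (suc J) y w ≡ y == w
    classW = classAfter i≤J a₁≢b₁ a₁≈b₁ split₁ w∈P₁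
    countBefore : ∀ u → nbCount G J u w ≡ ind (adj G u a₁) + ind (adj G u b₁)
    countBefore u = trans (count-cong G (λ y → cong (adj G u y ∧_) (classP₁ y))) (nbIn-pair u a₁≢b₁)
    countAfter : ∀ u → nbCount G (suc J) u w ≡ ind (adj G u w)
    countAfter u = trans (count-cong G (λ y → cong (adj G u y ∧_) (classW y)))
                         (trans (count≡size G _) (size-at (adj G u) w))
    sameTotal : ind (adj G a₂ a₁) + ind (adj G a₂ b₁) ≡ ind (adj G b₂ a₁) + ind (adj G b₂ b₁)
    sameTotal = begin-equality
      ind (adj G a₂ a₁) + ind (adj G a₂ b₁)  ≡⟨ countBefore a₂ ⟨
      nbCount G J a₂ w                       ≡⟨ proj₂ (≈-suc⁻ J (proj₁ split₂)) w ⟩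
      nbCount G J b₂ w                       ≡⟨ countBefore b₂ ⟩
      ind (adj G b₂ a₁) + ind (adj G b₂ b₁)  ∎
    differsAt : ∀ {y} → w ≡ y → adj G a₂ y ≢ adj G b₂ y
    differsAt refl same =
      differ (trans (countAfter a₂) (trans (cong ind same) (sym (countAfter b₂))))
    adjacencyDiffers : adj G a₂ a₁ ≢ adj G b₂ a₁ ⊎ adj G a₂ b₁ ≢ adj G b₂ b₁
    adjacencyDiffers = Sum.map differsAt differsAt w∈P₁

corollary16 : (n : ℕ) (G : Graph n) → LongRefinement G → DegSet23 G →
    (i : ℕ) → (∀ v → classSize G i v ≡ 2) →
    (a₁ b₁ a₂ b₂ : Fin n) (j₁ j₂ : ℕ) →
    a₁ ≢ b₁ → _~[_]_ G a₁ i b₁ → a₂ ≢ b₂ → _~[_]_ G a₂ i b₂ →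
    SplitAt G a₁ b₁ j₁ → SplitAt G a₂ b₂ j₂ → j₁ < j₂ →
    (∀ (a b : Fin n) (j : ℕ) → a ≢ b → _~[_]_ G a i b → SplitAt G a b j →
      ¬ (j₁ < j × j < j₂)) →
    (nbIn G a₁ a₂ b₂ ≡ 1 × nbIn G b₁ a₂ b₂ ≡ 1)
      × (nbIn G a₂ a₁ b₁ ≡ 1 × nbIn G b₂ a₁ b₁ ≡ 1)
corollary16 n G LR _ i pairs a₁ b₁ a₂ b₂ j₁ j₂ a₁≢b₁ a₁≈b₁ a₂≢b₂ _ split₁ split₂ j₁<j₂ noneBetween =
  successiveSplits i≤j₁ a₁≢b₁ a₁≈b₁ a₂≢b₂ split₁ split₂′
  where
  open Refinement G using (splitRound)
  open PairClasses G LR i pairs using (previousSplit; successiveSplits)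

  i≤j₁ : i ≤ j₁
  i≤j₁ = splitRound a₁≈b₁ split₁

  nextRound : ∀ {j} → j₁ < j → j ≤ j₂ → SplitAt G a₂ b₂ j → j ≡ suc j₁
  nextRound {suc m} (s≤s j₁≤m) m<j₂ split with previousSplit (≤-trans i≤j₁ j₁≤m) split
  ... | x , w , x≢w , x≈w , splitXW =
    cong suc (≤-antisym (≮⇒≥ (λ j₁<m → noneBetween x w m x≢w x≈w splitXW (j₁<m , m<j₂))) j₁≤m)

  split₂′ : SplitAt G a₂ b₂ (suc j₁)
  split₂′ = subst (SplitAt G a₂ b₂) (nextRound j₁<j₂ ≤-refl split₂) split₂
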